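{- Let $\mathcal{A}$ be a weakly acyclic NFA. Then the DFA obtained from $\mathcal{A}$ by the powerset (subset) construction is a weakly acyclic DFA.
   Context: For a word $w$, $\mathrm{alp}(w)$ is the set of letters occurring in $w$, and $\Sigma^+$ is the set of nonempty words over $\Sigma$. A DFA $(Q,\Sigma,\delta,q_0,F)$ is weakly acyclic if for every $q\in Q$, every $w\in\Sigma^+$ and every $a\in\mathrm{alp}(w)$, $\delta(q,w)=q$ implies $\delta(q,a)=q$ (equivalently, its state graph has no cycles other than self-loops). An NFA $(Q,\Sigma,\delta,q_0,F)$ is weakly acyclic if for every $q\in Q$ and $w\in\Sigma^+$, $q\in\delta(q,w)$ implies $\delta(q,a)=\{q\}$ for all $a\in\mathrm{alp}(w)$. The powerset construction has states the subsets of $Q$, with transitions $R\xrightarrow{a}\delta(R,a):=\bigcup_{q\in R}\delta(q,a)$. -}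

module Defs where

open import Data.Nat using (ℕ)
open import Data.Fin using (Fin)
open import Data.Fin.Subset using (Subset; ⋃; ⁅_⁆; _∈_)
open import Data.Bool using (Bool; true; false)
open import Data.List using (List; []; _∷_; filter)
open import Data.List.NonEmpty using (List⁺; toList)
open import Data.List.Membership.Propositional renaming (_∈_ to _∈ₗ_)
open import Data.Vec using (lookup)
open import Data.Bool.ListAction using (any)
open import Data.List using (allFin)
open import Relation.Binary.PropositionalEquality using (_≡_)

record DFA (Q : Set) (k : ℕ) : Set where
  field
    δ  : Q → Fin k → Q
    q₀ : Q
    F  : Q → Bool

record NFA (n k : ℕ) : Set where
  field
    δ  : Fin n → Fin k → Subset n
    q₀ : Fin n
    F  : Subset n

δ* : ∀ {Q k} → DFA Q k → Q → List (Fin k) → Q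
δ* A q []      = q
δ* A q (a ∷ w) = δ* A (DFA.δ A q a) w

δᴾ : ∀ {n k} → NFA n k → Subset n → Fin k → Subset n
δᴾ A R a = ⋃ (Data.List.map (λ q → NFA.δ A q a) (filter (λ q → Data.Bool._≟_ (lookup R q) true) (allFin _)))
  where import Data.List
        import Data.Bool

δ*ₙ : ∀ {n k} → NFA n k → Fin n → List (Fin k) → Subset n
δ*ₙ A q w = go ⁅ q ⁆ w
  where
    go : Subset _ → List (Fin _) → Subset _
    go R []      = R
    go R (a ∷ w) = go (δᴾ A R a) w

_∈alp_ : ∀ {k} → Fin k → List⁺ (Fin k) → Set
a ∈alp w = a ∈ₗ toList w

WeaklyAcyclicDFA : ∀ {Q k} → DFA Q k → Set
WeaklyAcyclicDFA {Q} {k} A =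
  ∀ (q : Q) (w : List⁺ (Fin k)) (a : Fin k) → a ∈alp w →
  δ* A q (toList w) ≡ q → DFA.δ A q a ≡ q

WeaklyAcyclicNFA : ∀ {n k} → NFA n k → Set
WeaklyAcyclicNFA {n} {k} A =
  ∀ (q : Fin n) (w : List⁺ (Fin k)) → q ∈ δ*ₙ A q (toList w) →
  ∀ (a : Fin k) → a ∈alp w → NFA.δ A q a ≡ ⁅ q ⁆

powersetDFA : ∀ {n k} → NFA n k → DFA (Subset n) k
powersetDFA A = record
  { δ  = δᴾ A
  ; q₀ = ⁅ NFA.q₀ A ⁆
  ; F  = λ R → any (λ q → lookup R q Data.Bool.∧ lookup (NFA.F A) q) (allFin _)
  }
  where import Data.Bool

module Submission where

-- If δ(R, w) = R for a nonempty word w, every state of R has a w-predecessor in R.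
-- Walking backwards from x ∈ R through such predecessors, some state q repeats within
-- n steps, so q lies on a cycle reading a power of w; weak acyclicity of the NFA then
-- makes every letter of w a pure self-loop at q. As q reaches x by reading w's letters,
-- x = q. Hence every state of R loops on every letter a of w, and δ(R, a) = R.

open import Data.Nat using (ℕ)
open import Defs

open import Data.Nat.Base using (zero; suc; _≤′_; ≤′-refl; ≤′-step)
open import Data.Nat.Properties using (n<1+n; ≤⇒≤′; z≤′n)
open import Data.Fin using (Fin; toℕ)
open import Data.Fin.Properties using (pigeonhole)
open import Data.Fin.Subset using (Subset; ⁅_⁆; ⋃; _∈_)
open import Data.Fin.Subset.Properties using (x∈⁅x⁆; x∈⁅y⁆⇒x≡y; ⊆-antisym; x∈p∪q⁻; x∈p∪q⁺; ∉⊥)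
open import Data.Bool using (true; _≟_)
open import Data.List using (List; []; _∷_; _++_; allFin)
open import Data.List.NonEmpty using () renaming (_∷_ to _∷⁺_)
open import Data.List.Membership.Propositional renaming (_∈_ to _∈ₗ_)
open import Data.List.Membership.Propositional.Properties
  using (∈-map⁻; ∈-map⁺; ∈-filter⁻; ∈-filter⁺; ∈-allFin; ∈-++⁺ˡ)
open import Data.List.Relation.Unary.Any using (here; there)
open import Data.Vec using (lookup)
open import Data.Vec.Properties using ([]=⇒lookup; lookup⇒[]=)
open import Data.Product using (Σ; ∃; _×_; _,_; proj₁; proj₂; map₂)
open import Data.Sum using (inj₁; inj₂)
open import Data.Empty using (⊥-elim)
open import Function using (_∘_)
open import Level using (Level)
open import Relation.Binary.Core using (Rel)
open import Relation.Binary.Construct.Closure.ReflexiveTransitive using (Star; ε; _◅_)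
open import Relation.Binary.Construct.Closure.Transitive using (TransClosure; [_]; _∷_)
open import Relation.Binary.PropositionalEquality using (_≡_; refl; sym; subst)
open import Relation.Unary using (Pred)

∈-⋃⁻ : ∀ {n} (Ss : List (Subset n)) {x} → x ∈ ⋃ Ss → ∃ λ S → S ∈ₗ Ss × x ∈ S
∈-⋃⁻ []       x∈ = ⊥-elim (∉⊥ x∈)
∈-⋃⁻ (S ∷ Ss) x∈ with x∈p∪q⁻ S (⋃ Ss) x∈
... | inj₁ x∈S  = S , here refl , x∈S
... | inj₂ x∈⋃ with ∈-⋃⁻ Ss x∈⋃
...   | T , T∈Ss , x∈T = T , there T∈Ss , x∈T

∈-⋃⁺ : ∀ {n} (Ss : List (Subset n)) {x S} → S ∈ₗ Ss → x ∈ S → x ∈ ⋃ Ss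
∈-⋃⁺ (S ∷ Ss) (here refl) x∈S = x∈p∪q⁺ (inj₁ x∈S)
∈-⋃⁺ (S ∷ Ss) (there S∈)  x∈S = x∈p∪q⁺ (inj₂ (∈-⋃⁺ Ss S∈ x∈S))

module _ {n : ℕ} {ℓ p : Level} {_⇝_ : Rel (Fin n) ℓ} {P : Pred (Fin n) p}
         (has-pred : ∀ {x} → P x → ∃ λ y → P y × y ⇝ x) where

  private
    module Ancestors {x} (x∈P : P x) where
      ancestor-in : ℕ → Σ (Fin n) P
      ancestor-in zero    = x , x∈P
      ancestor-in (suc i) = map₂ proj₁ (has-pred (proj₂ (ancestor-in i)))

      ancestor : ℕ → Fin n
      ancestor i = proj₁ (ancestor-in i)

      step : ∀ i → ancestor (suc i) ⇝ ancestor i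
      step i = proj₂ (proj₂ (has-pred (proj₂ (ancestor-in i))))

      descend* : ∀ {i j} → i ≤′ j → Star _⇝_ (ancestor j) (ancestor i)
      descend* ≤′-refl           = ε
      descend* (≤′-step {j} i≤j) = step j ◅ descend* i≤j

      descend⁺ : ∀ {i j} → suc i ≤′ j → TransClosure _⇝_ (ancestor j) (ancestor i)
      descend⁺ {i} ≤′-refl       = [ step i ]
      descend⁺ (≤′-step {j} i<j) = step j ∷ descend⁺ i<j

  reached-from-cycle : ∀ {x} → P x → ∃ λ y → TransClosure _⇝_ y y × Star _⇝_ y x
  reached-from-cycle x∈P with pigeonhole (n<1+n n) (ancestor ∘ toℕ)
    where open Ancestors x∈P
  ... | i , j , i<j , same =
    ancestor (toℕ i) , subst (λ y → TransClosure _⇝_ y _) (sym same) (descend⁺ (≤⇒≤′ i<j))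
                     , descend* {j = toℕ i} z≤′n
    where open Ancestors x∈P

module _ {n k : ℕ} (A : NFA n k) where
  open NFA A using (δ)

  private
    𝒫 = powersetDFA A

  infixr 5 _∷_
  data _–[_]→_ : Fin n → List (Fin k) → Fin n → Set where
    []  : ∀ {q} → q –[ [] ]→ q
    _∷_ : ∀ {q r a w x} → r ∈ δ q a → r –[ w ]→ x → q –[ a ∷ w ]→ x

  run-++ : ∀ {q r x u v} → q –[ u ]→ r → r –[ v ]→ x → q –[ u ++ v ]→ x
  run-++ []          r→x = r→x
  run-++ (s∈ ∷ s→r) r→x = s∈ ∷ run-++ s→r r→x

  ∈-δᴾ⁻ : ∀ R a {x} → x ∈ δᴾ A R a → ∃ λ q → q ∈ R × x ∈ δ q a
  ∈-δᴾ⁻ R a x∈ with ∈-⋃⁻ _ x∈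
  ... | S , S∈ , x∈S with ∈-map⁻ (λ q → δ q a) S∈
  ... | q , q∈ , refl with ∈-filter⁻ (λ q → lookup R q ≟ true) {xs = allFin n} q∈
  ... | _ , Rq≡true = q , lookup⇒[]= q R Rq≡true , x∈S

  ∈-δᴾ⁺ : ∀ R a {q x} → q ∈ R → x ∈ δ q a → x ∈ δᴾ A R a
  ∈-δᴾ⁺ R a {q} q∈R x∈ =
    ∈-⋃⁺ _ (∈-map⁺ (λ q → δ q a) (∈-filter⁺ (λ q → lookup R q ≟ true) (∈-allFin q) ([]=⇒lookup q∈R))) x∈

  ∈-δ*⁻ : ∀ R w {x} → x ∈ δ* 𝒫 R w → ∃ λ q → q ∈ R × q –[ w ]→ x
  ∈-δ*⁻ R []      x∈ = _ , x∈ , []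
  ∈-δ*⁻ R (a ∷ w) x∈ with ∈-δ*⁻ (δᴾ A R a) w x∈
  ... | r , r∈ , r→x with ∈-δᴾ⁻ R a r∈
  ... | q , q∈R , r∈δqa = q , q∈R , r∈δqa ∷ r→x

  ∈-δ*⁺ : ∀ R {q w x} → q ∈ R → q –[ w ]→ x → x ∈ δ* 𝒫 R w
  ∈-δ*⁺ R q∈R []         = q∈R
  ∈-δ*⁺ R q∈R (r∈ ∷ r→x) = ∈-δ*⁺ (δᴾ A R _) (∈-δᴾ⁺ R _ q∈R r∈) r→x

  -- δ*ₙ iterates δᴾ through a where-bound helper that cannot be named;
  -- the with-abstraction in loop-unfolds makes unification solve loop as that helper.
  private
    mutual
      loop : Fin n → List (Fin k) → Subset n → List (Fin k) → Subset n
      loop = _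

      loop-unfolds : ∀ q a u → δ*ₙ A q (a ∷ u) ≡ δ*ₙ A q (a ∷ u)
      loop-unfolds q a u with δᴾ A ⁅ q ⁆ a | a ∷ u
      ... | R | w = refl {x = loop q w R u}

    loop≡δ* : ∀ q w R u → loop q w R u ≡ δ* 𝒫 R u
    loop≡δ* q w R []      = refl
    loop≡δ* q w R (a ∷ u) = loop≡δ* q w (δᴾ A R a) u

  δ*ₙ≡δ*-powerset : ∀ q w → δ*ₙ A q w ≡ δ* 𝒫 ⁅ q ⁆ w
  δ*ₙ≡δ*-powerset q w = loop≡δ* q w ⁅ q ⁆ w

  run⇒∈δ*ₙ : ∀ {q w x} → q –[ w ]→ x → x ∈ δ*ₙ A q w
  run⇒∈δ*ₙ {q} {w} {x} q→x =
    subst (x ∈_) (sym (δ*ₙ≡δ*-powerset q w)) (∈-δ*⁺ ⁅ q ⁆ (x∈⁅x⁆ q) q→x)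

  plus⇒run : ∀ {w q x} → TransClosure (_–[ w ]→_) q x → ∃ λ u → q –[ w ++ u ]→ x
  plus⇒run [ q→x ]       = [] , run-++ q→x []
  plus⇒run (q→r ∷ r→⁺x) with plus⇒run r→⁺x
  ... | _ , r→x = _ , run-++ q→r r→x

  Stable : List (Fin k) → Fin n → Set
  Stable w q = ∀ {a} → a ∈ₗ w → δ q a ≡ ⁅ q ⁆

  stable-run-stays : ∀ {q w x} → Stable w q → q –[ w ]→ x → x ≡ q
  stable-run-stays     st []          = refl
  stable-run-stays {q} st (r∈ ∷ r→x) with x∈⁅y⁆⇒x≡y q (subst (_ ∈_) (st (here refl)) r∈)
  ... | refl = stable-run-stays (st ∘ there) r→x

  stable-star-stays : ∀ {w q x} → Stable w q → Star (_–[ w ]→_) q x → x ≡ q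
  stable-star-stays st ε           = refl
  stable-star-stays st (q→r ◅ r→*x) with stable-run-stays st q→r
  ... | refl = stable-star-stays st r→*x

  cycle⇒stable : WeaklyAcyclicNFA A → ∀ {q b w} → TransClosure (_–[ b ∷ w ]→_) q q → Stable (b ∷ w) q
  cycle⇒stable wa {q} {b} {w} q→⁺q a∈ with plus⇒run q→⁺q
  ... | u , q→q = wa q (b ∷⁺ (w ++ u)) (run⇒∈δ*ₙ q→q) _ (∈-++⁺ˡ a∈)

  invariant⇒stable : WeaklyAcyclicNFA A → ∀ {R b w x} →
                     δ* 𝒫 R (b ∷ w) ≡ R → x ∈ R → Stable (b ∷ w) x
  invariant⇒stable wa {R} {b} {w} R-inv x∈R =
    let q , q→⁺q , q→*x = reached-from-cycle has-pred x∈R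
        q-stable = cycle⇒stable wa q→⁺q
    in subst (Stable (b ∷ w)) (sym (stable-star-stays q-stable q→*x)) q-stable
    where
      has-pred : ∀ {x} → x ∈ R → ∃ λ q → q ∈ R × q –[ b ∷ w ]→ x
      has-pred {x} x∈R = ∈-δ*⁻ R (b ∷ w) (subst (x ∈_) (sym R-inv) x∈R)

  self-loops⇒δᴾ-fixes : ∀ {R a} → (∀ {x} → x ∈ R → δ x a ≡ ⁅ x ⁆) → δᴾ A R a ≡ R
  self-loops⇒δᴾ-fixes {R} {a} loops = ⊆-antisym δᴾR⊆R R⊆δᴾR
    where
      δᴾR⊆R : ∀ {x} → x ∈ δᴾ A R a → x ∈ R
      δᴾR⊆R x∈ with ∈-δᴾ⁻ R a x∈
      ... | q , q∈R , x∈δqa with x∈⁅y⁆⇒x≡y q (subst (_ ∈_) (loops q∈R) x∈δqa)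
      ...   | refl = q∈R

      R⊆δᴾR : ∀ {x} → x ∈ R → x ∈ δᴾ A R a
      R⊆δᴾR {x} x∈R = ∈-δᴾ⁺ R a x∈R (subst (x ∈_) (sym (loops x∈R)) (x∈⁅x⁆ x))

proposition1 : ∀ {n k : ℕ} (A : NFA n k) →
    WeaklyAcyclicNFA A → WeaklyAcyclicDFA (powersetDFA A)
proposition1 A wa R (b ∷⁺ w) a a∈w R-inv =
  self-loops⇒δᴾ-fixes A (λ x∈R → invariant⇒stable A wa R-inv x∈R a∈w)
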